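{- Let $G$ be a graph, $x,z:\mathsf{N}_G$, and $w:\mathsf{W}_G(x,z)$ a walk of length $n$. Then $⟦n⟧\simeq\sum_{y:\mathsf{N}_G}(y\in w)$.
   Context: Setting: homotopy type theory. $⟦n⟧$ is the $n$-element type: $⟦0⟧:\equiv\mathbb{0}$, $⟦1⟧:\equiv\mathbb{1}$, $⟦n+1⟧:\equiv⟦n⟧+\mathbb{1}$. A graph $G$: a set $\mathsf{N}_G$ of nodes and sets $\mathsf{E}_G(x,y)$ of edges. Walks: inductive family $\mathsf{W}_G(x,y)$ with $\langle x\rangle:\mathsf{W}_G(x,x)$ and $e\odot w:\mathsf{W}_G(x,z)$ for $e:\mathsf{E}_G(x,y)$, $w:\mathsf{W}_G(y,z)$; $\mathsf{length}(\langle x\rangle)=0$, $\mathsf{length}(e\odot w)=\mathsf{length}(w)+1$. For a node $y$: $y\in\langle z\rangle:\equiv\mathbb{0}$, $y\in(e\odot w):\equiv(y=\mathsf{source}(e))+(y\in w)$. -}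

module Defs where

open import Level using (Level; _⊔_) renaming (suc to lsuc)
open import Data.Nat using (ℕ; zero; suc)
open import Data.Empty.Polymorphic using (⊥)
open import Data.Unit.Polymorphic using (⊤)
open import Data.Sum using (_⊎_)
open import Relation.Binary.PropositionalEquality using (_≡_)
open import Axiom.UniquenessOfIdentityProofs using (UIP)

⟦_⟧ : ∀ {ℓ} → ℕ → Set ℓ
⟦ zero ⟧ = ⊥
⟦ suc zero ⟧ = ⊤
⟦_⟧ {ℓ} (suc (suc n)) = ⟦_⟧ {ℓ} (suc n) ⊎ ⊤ {ℓ}

record Graph (ℓ₁ ℓ₂ : Level) : Set (lsuc (ℓ₁ ⊔ ℓ₂)) where
  field
    Node    : Set ℓ₁
    Edge    : Node → Node → Set ℓ₂
    Node-isSet : UIP Node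
    Edge-isSet : ∀ x y → UIP (Edge x y)

module _ {ℓ₁ ℓ₂} (G : Graph ℓ₁ ℓ₂) where
  open Graph G

  data Walk : Node → Node → Set (ℓ₁ ⊔ ℓ₂) where
    ⟨_⟩ : (x : Node) → Walk x x
    _⊙_ : ∀ {x y z} → Edge x y → Walk y z → Walk x z

  length : ∀ {x z} → Walk x z → ℕ
  length ⟨ x ⟩ = 0
  length (e ⊙ w) = suc (length w)

  source : ∀ {x y} → Edge x y → Node
  source {x} _ = x

  _∈_ : Node → ∀ {x z} → Walk x z → Set ℓ₁
  y ∈ ⟨ z ⟩ = ⊥
  y ∈ (e ⊙ w) = (y ≡ source e) ⊎ (y ∈ w)

{-# OPTIONS --safe #-}
module Submission where

-- Since y ∈ w is a sum rather than a proposition, Σ y (y ∈ w) counts nodes with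
-- multiplicity: each edge e ⊙ − contributes exactly one summand, its source, so
-- induction on the walk matches ⟦ suc n ⟧ ↔ ⟦ n ⟧ ⊎ ⊤ step by step.

open import Defs
open import Data.Nat using (ℕ; zero; suc)
open import Data.Product using (Σ; _,_)
open import Data.Sum using (_⊎_)
open import Data.Unit.Polymorphic using (⊤; tt)
open import Relation.Binary.PropositionalEquality using (_≡_; refl)
open import Function.Bundles using (_↔_; mk↔ₛ′)
open import Function.Properties.Inverse using (↔-refl; ↔-sym)
open import Function.Related.Propositional using (bijection; module EquationalReasoning)
open import Function.Related.TypeIsomorphisms using (×-zeroʳ; ⊎-comm; ⊎-identityˡ; Σ-distribˡ-⊎)
open import Data.Sum.Function.Propositional using (_⊎-↔_)

open EquationalReasoning {k = bijection}

⟦suc⟧↔⟦⟧⊎⊤ : ∀ {ℓ} n → ⟦_⟧ {ℓ} (suc n) ↔ (⟦_⟧ {ℓ} n ⊎ ⊤ {ℓ})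
⟦suc⟧↔⟦⟧⊎⊤ {ℓ} zero    = ↔-sym (⊎-identityˡ ℓ ⊤)
⟦suc⟧↔⟦⟧⊎⊤     (suc n) = ↔-refl

Σ-≡↔⊤ : ∀ {a} {A : Set a} (x : A) → Σ A (λ y → y ≡ x) ↔ ⊤ {a}
Σ-≡↔⊤ x = mk↔ₛ′ (λ _ → tt) (λ _ → x , refl) (λ _ → refl) (λ { (_ , refl) → refl })

module _ {ℓ₁ ℓ₂} (G : Graph ℓ₁ ℓ₂) where
  open Graph G

  ⟦length⟧↔nodes : ∀ {x z} (w : Walk G x z) → ⟦_⟧ {ℓ₁} (length G w) ↔ Σ Node (λ y → _∈_ G y w)
  ⟦length⟧↔nodes ⟨ x ⟩ = ↔-sym (×-zeroʳ ℓ₁ Node)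
  ⟦length⟧↔nodes {x} (e ⊙ w) = begin
    ⟦ suc (length G w) ⟧                             ↔⟨ ⟦suc⟧↔⟦⟧⊎⊤ (length G w) ⟩
    (⟦ length G w ⟧ ⊎ ⊤)                             ↔⟨ ⟦length⟧↔nodes w ⊎-↔ ↔-sym (Σ-≡↔⊤ x) ⟩
    (Σ Node (λ y → _∈_ G y w) ⊎ Σ Node (_≡ x))       ↔⟨ ⊎-comm _ _ ⟩
    (Σ Node (_≡ x) ⊎ Σ Node (λ y → _∈_ G y w))       ↔⟨ Σ-distribˡ-⊎ ⟨
    Σ Node (λ y → _∈_ G y (e ⊙ w))                   ∎

lemma4p15 : ∀ {ℓ₁ ℓ₂} (G : Graph ℓ₁ ℓ₂) {x z : Graph.Node G} (w : Walk G x z) (n : ℕ) →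
    length G w ≡ n →
    ⟦_⟧ {ℓ₁} n ↔ Σ (Graph.Node G) (λ y → _∈_ G y w)
lemma4p15 G w _ refl = ⟦length⟧↔nodes G w
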